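{- Let $A=\langle A_i : i\in\mathbb{N}\rangle$ be a computable nontrivial family of sets. Every set $D$ of degree hyperimmune relative to $\mathbf{0}'$ computes a maximal subfamily of $A$ with the $F$ intersection property.
   Context: A family of sets is a sequence $A=\langle A_i : i\in\mathbb{N}\rangle$ of subsets of $\mathbb{N}$ (computable if the relation $x\in A_i$ is computable); it is nontrivial if $A_i\neq\emptyset$ for some $i$. A set $X$ is in $A$ if $X=A_i$ for some $i$; $B=\langle B_i\rangle$ is a subfamily of $A$ if $(\forall i)(\exists j)[B_i=A_j]$. Two sets are distinct if they differ extensionally. A family has the $F$ intersection property if for every $m\ge 2$ the intersection of any $m$ distinct sets in it is nonempty. A subfamily $B$ of $A$ with the $F$ intersection property is maximal if for every subfamily $C$ of $A$ with this property, $B$ being a subfamily of $C$ implies $C$ is a subfamily of $B$. A set $D$ has degree hyperimmune relative to $\mathbf{0}'$ if $D$ computes a function not dominated by any $\emptyset'$-computable function. "Computes a subfamily" means the sequence $B$ (coded as a set) is Turing reducible to $D$. -}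

module Defs where

open import Data.Nat using (ℕ; zero; suc; _+_; _∸_; _≤_; _<_; _≥_)
open import Data.Fin using (Fin)
open import Data.Product using (Σ; ∃; _×_; _,_; proj₁; proj₂)
open import Data.Empty using (⊥)
open import Relation.Nullary using (¬_)
open import Relation.Binary.PropositionalEquality using (_≡_; _≢_)

tri : ℕ → ℕ
tri zero    = zero
tri (suc d) = suc d + tri d

pair : ℕ → ℕ → ℕ
pair x y = tri (x + y) + x

-- inverse of pair, by enumerating the diagonals
-- (0,0),(0,1),(1,0),(0,2),(1,1),(2,0),...
next : ℕ × ℕ → ℕ × ℕ
next (x , suc y) = (suc x , y)
next (x , zero)  = (zero , suc x)

unpair : ℕ → ℕ × ℕ
unpair zero    = (zero , zero)
unpair (suc n) = next (unpair n)

-- Oracle partial recursive functions (unary, with pairing).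
-- A standard Turing-complete basis:
--   zero, successor, identity, the two projections of the pairing,
--   pairing of two functions, composition, primitive recursion,
--   unbounded minimisation, and an oracle query.

data Code : Set where
  zeroC succC idC fstC sndC orcC : Code
  pairC compC precC : Code → Code → Code
  muC : Code → Code

SubsetN : Set₁
SubsetN = ℕ → Set

-- Big-step evaluation relation:  Eval X c x y  means  φ_c^X(x)↓ = y.
data Eval (X : SubsetN) : Code → ℕ → ℕ → Set where
  ev-zero : ∀ {x} → Eval X zeroC x 0
  ev-succ : ∀ {x} → Eval X succC x (suc x)
  ev-id   : ∀ {x} → Eval X idC x x
  ev-fst  : ∀ {a b} → Eval X fstC (pair a b) a
  ev-snd  : ∀ {a b} → Eval X sndC (pair a b) b
  ev-orc1 : ∀ {x} → X x → Eval X orcC x 1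
  ev-orc0 : ∀ {x} → ¬ X x → Eval X orcC x 0
  ev-pair : ∀ {f g x a b} → Eval X f x a → Eval X g x b →
            Eval X (pairC f g) x (pair a b)
  -- compC f g computes f ∘ g
  ev-comp : ∀ {f g x y z} → Eval X g x y → Eval X f y z →
            Eval X (compC f g) x z
  ev-prec0 : ∀ {f g x y} → Eval X f x y → Eval X (precC f g) (pair 0 x) y
  ev-precS : ∀ {f g n x y z} → Eval X (precC f g) (pair n x) y →
             Eval X g (pair x (pair n y)) z →
             Eval X (precC f g) (pair (suc n) x) z
  ev-mu : ∀ {f x n} → Eval X f (pair n x) 0 →
          (∀ m → m < n → Σ ℕ λ k → Eval X f (pair m x) (suc k)) →
          Eval X (muC f) x n

-- The fuel argument is structural; fuel n suffices since a , b < n.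

decodeF : ℕ → ℕ → Code
decodeF zero _ = zeroC
decodeF (suc fuel) 0 = zeroC
decodeF (suc fuel) 1 = succC
decodeF (suc fuel) 2 = idC
decodeF (suc fuel) 3 = fstC
decodeF (suc fuel) 4 = sndC
decodeF (suc fuel) 5 = orcC
decodeF (suc fuel) (suc (suc (suc (suc (suc (suc m)))))) = go (unpair m)
  where
  go : ℕ × ℕ → Code
  go (t , r) with unpair r
  ... | (a , b) with t
  ...   | 0 = pairC (decodeF fuel a) (decodeF fuel b)
  ...   | 1 = compC (decodeF fuel a) (decodeF fuel b)
  ...   | 2 = precC (decodeF fuel a) (decodeF fuel b)
  ...   | _ = muC (decodeF fuel a)

decode : ℕ → Code
decode n = decodeF n n

∅ : SubsetN
∅ _ = ⊥

∅′ : SubsetN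
∅′ n = Σ ℕ λ e → Σ ℕ λ x → n ≡ pair e x × Σ ℕ λ y → Eval ∅ (decode e) x y

ComputableFrom : SubsetN → (ℕ → ℕ) → Set
ComputableFrom X f = Σ Code λ c → ∀ x → Eval X c x (f x)

TuringReducible : SubsetN → SubsetN → Set
TuringReducible Y X =
  Σ Code λ c → ∀ x → (Y x → Eval X c x 1) × (¬ Y x → Eval X c x 0)

Dominates : (ℕ → ℕ) → (ℕ → ℕ) → Set
Dominates g f = Σ ℕ λ N → ∀ x → x ≥ N → f x ≤ g x

HyperimmuneRel0′ : SubsetN → Set
HyperimmuneRel0′ D =
  Σ (ℕ → ℕ) λ f → ComputableFrom D f ×
    (∀ g → ComputableFrom ∅′ g → ¬ Dominates g f)

Family : Set₁
Family = ℕ → SubsetN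

code : Family → SubsetN
code A n = Σ ℕ λ i → Σ ℕ λ x → n ≡ pair i x × A i x

ComputableFamily : Family → Set
ComputableFamily A = TuringReducible (code A) ∅

Nontrivial : Family → Set
Nontrivial A = Σ ℕ λ i → Σ ℕ λ x → A i x

_≐_ : SubsetN → SubsetN → Set
X ≐ Y = ∀ x → (X x → Y x) × (Y x → X x)

Subfamily : Family → Family → Set
Subfamily B A = ∀ i → Σ ℕ λ j → B i ≐ A j

FIP : Family → Set
FIP A = ∀ m → 2 ≤ m → (idx : Fin m → ℕ) →
        (∀ k l → k ≢ l → ¬ (A (idx k) ≐ A (idx l))) →
        Σ ℕ λ x → ∀ k → A (idx k) x

MaximalFIPSubfamily : Family → Family → Set₁
MaximalFIPSubfamily B A =
  Subfamily B A × FIP B ×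
  (∀ (C : Family) → Subfamily C A → FIP C → Subfamily B C → Subfamily C B)

ComputesFamily : SubsetN → Family → Set
ComputesFamily D B = TuringReducible (code B) D

module Submission where

open import Defs
open import Data.Product using (Σ; _×_)
open import Axiom.ExcludedMiddle using (ExcludedMiddle)
open import Level using (0ℓ)

open import Data.Product using (_,_; proj₁; proj₂)
open import Data.Nat
open import Data.Nat.Properties
open import Data.Empty using (⊥-elim)
open import Data.Sum using (_⊎_; inj₁; inj₂)
open import Data.Bool using (Bool; true; false; _∧_; _∨_; not; T; if_then_else_)
open import Data.Bool.Properties using (not-involutive)
open import Data.Fin using (Fin; zero; suc; toℕ; fromℕ<; punchIn; punchOut)
open import Data.Fin.Properties using (punchIn-punchOut; toℕ-fromℕ<)
open import Data.Vec using (Vec; []; _∷_; lookup; head; tail)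
open import Function using (_∘_)
open import Relation.Nullary using (¬_; Dec; yes; no; does)
open import Relation.Nullary.Decidable using (T?)
open import Relation.Binary.PropositionalEquality
open import Relation.Binary.Definitions using (tri<; tri≈; tri>)

-- If some A j is empty, the constant family A j already works.  Otherwise,
-- with f ≤_T D escaping every ∅′-computable function, D builds finite sets of
-- indices stage 0 = {0} ⊆ stage 1 ⊆ ⋯ : at stage s+1 each j ≤ s is added
-- when A j meets the intersection of the sets chosen so far at some point
-- ≤ f s.  B lists the chosen sets; every finite intersection of them is
-- nonempty by the stage invariant.  If C ⊇ B has the F intersection property
-- and contains some A a with a never chosen, then for all s ≥ a the least
-- such point exceeds f s, and these least points are bounded by an
-- ∅′-computable function — contradicting the choice of f.
--
-- Excluded middle (a hypothesis of the
-- statement) is used to decide membership and the existence of witnesses.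

module Pairing where

  π₁ π₂ : ℕ → ℕ
  π₁ n = proj₁ (unpair n)
  π₂ n = proj₂ (unpair n)

  -- how pairing moves along a diagonal, mirroring the two clauses of next
  pair-sucˡ : ∀ x y → pair (suc x) y ≡ suc (pair x (suc y))
  pair-sucˡ x y rewrite +-suc x y | +-suc (tri (suc (x + y))) x = refl

  pair-zero-suc : ∀ y → pair 0 (suc y) ≡ suc (pair y 0)
  pair-zero-suc y rewrite +-identityʳ y | +-identityʳ (y + tri y) | +-comm y (tri y) = refl

  unpair-pair′ : ∀ n x y → pair x y ≡ n → unpair n ≡ (x , y)
  unpair-pair′ zero    zero    zero    eq = refl
  unpair-pair′ zero    zero    (suc y) eq rewrite pair-zero-suc y with eq
  ... | ()
  unpair-pair′ zero    (suc x) y       eq rewrite pair-sucˡ x y with eq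
  ... | ()
  unpair-pair′ (suc n) zero    zero    ()
  unpair-pair′ (suc n) zero    (suc y) eq rewrite pair-zero-suc y
                                         | unpair-pair′ n y zero (suc-injective eq) = refl
  unpair-pair′ (suc n) (suc x) y       eq rewrite pair-sucˡ x y
                                         | unpair-pair′ n x (suc y) (suc-injective eq) = refl

  unpair-pair : ∀ x y → unpair (pair x y) ≡ (x , y)
  unpair-pair x y = unpair-pair′ _ x y refl

  π₁-pair : ∀ x y → π₁ (pair x y) ≡ x
  π₁-pair x y = cong proj₁ (unpair-pair x y)

  π₂-pair : ∀ x y → π₂ (pair x y) ≡ y
  π₂-pair x y = cong proj₂ (unpair-pair x y)

  pair-π : ∀ n → pair (π₁ n) (π₂ n) ≡ n
  pair-π zero = refl
  pair-π (suc n) with unpair n | pair-π n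
  ... | (a , suc b) | ih = trans (pair-sucˡ a b) (cong suc ih)
  ... | (a , zero)  | ih = trans (pair-zero-suc a) (cong suc ih)

  pair-injective : ∀ {a b c d} → pair a b ≡ pair c d → a ≡ c × b ≡ d
  pair-injective {a} {b} {c} {d} eq =
    trans (sym (π₁-pair a b)) (trans (cong π₁ eq) (π₁-pair c d)) ,
    trans (sym (π₂-pair a b)) (trans (cong π₂ eq) (π₂-pair c d))

  tri-≥ : ∀ d → d ≤ tri d
  tri-≥ zero    = z≤n
  tri-≥ (suc d) = m≤m+n (suc d) (tri d)

  pair-≥₁ : ∀ a b → a ≤ pair a b
  pair-≥₁ a b = m≤n+m a (tri (a + b))

  pair-≥₂ : ∀ a b → b ≤ pair a b
  pair-≥₂ a b = ≤-trans (m≤n+m b a) (≤-trans (tri-≥ (a + b)) (m≤m+n (tri (a + b)) a))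

open Pairing

module Evaluation where

  -- Eval is functional: a code has at most one value on each input.
  -- (The inputs are kept apart, since pair-headed indices do not unify.)
  deterministic : ∀ {X c x x′ y y′} → Eval X c x y → Eval X c x′ y′ → x ≡ x′ → y ≡ y′
  deterministic ev-zero ev-zero _ = refl
  deterministic ev-succ ev-succ eq = cong suc eq
  deterministic ev-id ev-id eq = eq
  deterministic (ev-fst {a} {b}) (ev-fst {a′} {b′}) eq = proj₁ (pair-injective {a} {b} {a′} {b′} eq)
  deterministic (ev-snd {a} {b}) (ev-snd {a′} {b′}) eq = proj₂ (pair-injective {a} {b} {a′} {b′} eq)
  deterministic (ev-orc1 _) (ev-orc1 _) _ = refl
  deterministic (ev-orc1 p) (ev-orc0 ¬p) refl = ⊥-elim (¬p p)
  deterministic (ev-orc0 ¬p) (ev-orc1 p) refl = ⊥-elim (¬p p)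
  deterministic (ev-orc0 _) (ev-orc0 _) _ = refl
  deterministic (ev-pair a b) (ev-pair a′ b′) eq =
    cong₂ pair (deterministic a a′ eq) (deterministic b b′ eq)
  deterministic (ev-comp g f) (ev-comp g′ f′) eq = deterministic f f′ (deterministic g g′ eq)
  deterministic (ev-prec0 {x = x} a) (ev-prec0 {x = x′} a′) eq =
    deterministic a a′ (proj₂ (pair-injective {0} {x} {0} {x′} eq))
  deterministic (ev-prec0 {x = x} _) (ev-precS {n = n′} {x = x′} _ _) eq
    with proj₁ (pair-injective {0} {x} {suc n′} {x′} eq)
  ... | ()
  deterministic (ev-precS {n = n} {x = x} _ _) (ev-prec0 {x = x′} _) eq
    with proj₁ (pair-injective {suc n} {x} {0} {x′} eq)
  ... | ()
  deterministic (ev-precS {n = n} {x = x} h g) (ev-precS {n = n′} {x = x′} h′ g′) eq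
    with pair-injective {suc n} {x} {suc n′} {x′} eq
  ... | refl , refl with deterministic h h′ refl
  ... | refl = deterministic g g′ refl
  deterministic (ev-mu {n = n} p below) (ev-mu {n = n′} p′ below′) refl with <-cmp n n′
  ... | tri≈ _ e _ = e
  ... | tri< n<n′ _ _ with deterministic p (proj₂ (below′ n n<n′)) refl
  ... | ()
  deterministic (ev-mu p below) (ev-mu p′ below′) refl | tri> _ _ n′<n
    with deterministic p′ (proj₂ (below _ n′<n)) refl
  ... | ()

  -- Replacing every oracle query by the constant 0 turns an oracle-free
  -- computation into one that is valid relative to any oracle.
  strip : Code → Code
  strip zeroC       = zeroC
  strip succC       = succC
  strip idC         = idC
  strip fstC        = fstC
  strip sndC        = sndC
  strip orcC        = zeroC
  strip (pairC a b) = pairC (strip a) (strip b)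
  strip (compC a b) = compC (strip a) (strip b)
  strip (precC a b) = precC (strip a) (strip b)
  strip (muC a)     = muC (strip a)

  strip-runs : ∀ {X c x y} → Eval ∅ c x y → Eval X (strip c) x y
  strip-runs ev-zero          = ev-zero
  strip-runs ev-succ          = ev-succ
  strip-runs ev-id            = ev-id
  strip-runs (ev-fst {a} {b}) = ev-fst {a = a} {b = b}
  strip-runs (ev-snd {a} {b}) = ev-snd {a = a} {b = b}
  strip-runs (ev-orc1 ())
  strip-runs (ev-orc0 _)      = ev-zero
  strip-runs (ev-pair a b)    = ev-pair (strip-runs a) (strip-runs b)
  strip-runs (ev-comp a b)    = ev-comp (strip-runs a) (strip-runs b)
  strip-runs (ev-prec0 a)     = ev-prec0 (strip-runs a)
  strip-runs (ev-precS a b)   = ev-precS (strip-runs a) (strip-runs b)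
  strip-runs (ev-mu p below)  =
    ev-mu (strip-runs p) (λ m m<n → proj₁ (below m m<n) , strip-runs (proj₂ (below m m<n)))

module Encoding where

  encode : Code → ℕ
  encode zeroC       = 0
  encode succC       = 1
  encode idC         = 2
  encode fstC        = 3
  encode sndC        = 4
  encode orcC        = 5
  encode (pairC a b) = 6 + pair 0 (pair (encode a) (encode b))
  encode (compC a b) = 6 + pair 1 (pair (encode a) (encode b))
  encode (precC a b) = 6 + pair 2 (pair (encode a) (encode b))
  encode (muC a)     = 6 + pair 3 (pair (encode a) 0)

  left≤ : ∀ t a b fuel → 6 + pair t (pair a b) ≤ suc fuel → a ≤ fuel
  left≤ t a b fuel (s≤s le) =
    ≤-trans (≤-trans (pair-≥₁ a b) (pair-≥₂ t _)) (m+n≤o⇒n≤o 5 le)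

  right≤ : ∀ t a b fuel → 6 + pair t (pair a b) ≤ suc fuel → b ≤ fuel
  right≤ t a b fuel (s≤s le) =
    ≤-trans (≤-trans (pair-≥₂ a b) (pair-≥₂ t _)) (m+n≤o⇒n≤o 5 le)

  decodeF-encode : ∀ c fuel → encode c ≤ fuel → decodeF fuel (encode c) ≡ c
  decodeF-encode zeroC zero       _ = refl
  decodeF-encode zeroC (suc fuel) _ = refl
  decodeF-encode succC (suc fuel) _ = refl
  decodeF-encode idC   (suc fuel) _ = refl
  decodeF-encode fstC  (suc fuel) _ = refl
  decodeF-encode sndC  (suc fuel) _ = refl
  decodeF-encode orcC  (suc fuel) _ = refl
  decodeF-encode (pairC a b) (suc fuel) le
    rewrite unpair-pair 0 (pair (encode a) (encode b)) | unpair-pair (encode a) (encode b) =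
    cong₂ pairC (decodeF-encode a fuel (left≤ 0 (encode a) (encode b) fuel le))
          (decodeF-encode b fuel (right≤ 0 (encode a) (encode b) fuel le))
  decodeF-encode (compC a b) (suc fuel) le
    rewrite unpair-pair 1 (pair (encode a) (encode b)) | unpair-pair (encode a) (encode b) =
    cong₂ compC (decodeF-encode a fuel (left≤ 1 (encode a) (encode b) fuel le))
          (decodeF-encode b fuel (right≤ 1 (encode a) (encode b) fuel le))
  decodeF-encode (precC a b) (suc fuel) le
    rewrite unpair-pair 2 (pair (encode a) (encode b)) | unpair-pair (encode a) (encode b) =
    cong₂ precC (decodeF-encode a fuel (left≤ 2 (encode a) (encode b) fuel le))
          (decodeF-encode b fuel (right≤ 2 (encode a) (encode b) fuel le))
  decodeF-encode (muC a) (suc fuel) le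
    rewrite unpair-pair 3 (pair (encode a) 0) | unpair-pair (encode a) 0 =
    cong muC (decodeF-encode a fuel (left≤ 3 (encode a) 0 fuel le))

  decode-encode : ∀ c → decode (encode c) ≡ c
  decode-encode c = decodeF-encode c (encode c) ≤-refl

open Evaluation

-- Bounded quantifiers and sums over initial segments of ℕ, as Boolean
-- (hence computable) operations.
module BoundedQuantifiers where

  boolToℕ : Bool → ℕ
  boolToℕ true  = 1
  boolToℕ false = 0

  _⇒ᵇ_ : Bool → Bool → Bool
  true  ⇒ᵇ q = q
  false ⇒ᵇ _ = true

  T⇒true : ∀ {b} → T b → b ≡ true
  T⇒true {true} _ = refl

  ¬T⇒false : ∀ {b} → ¬ T b → b ≡ false
  ¬T⇒false {true}  ¬t = ⊥-elim (¬t _)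
  ¬T⇒false {false} _  = refl

  ∧-intro : ∀ {p q} → T p → T q → T (p ∧ q)
  ∧-intro {true} _ tq = tq

  ∧-elim : ∀ {p q} → T (p ∧ q) → T p × T q
  ∧-elim {true} tq = _ , tq

  ∨-introˡ : ∀ {p q} → T p → T (p ∨ q)
  ∨-introˡ {true} _ = _

  ∨-introʳ : ∀ p {q} → T q → T (p ∨ q)
  ∨-introʳ true  _  = _
  ∨-introʳ false tq = tq

  ∨-resolve : ∀ {p q} → T (p ∨ q) → ¬ T q → T p
  ∨-resolve {true}  _  _  = _
  ∨-resolve {false} tq ¬q = ⊥-elim (¬q tq)

  ⇒ᵇ-intro : ∀ {p q} → (T p → T q) → T (p ⇒ᵇ q)
  ⇒ᵇ-intro {true}  h = h _
  ⇒ᵇ-intro {false} h = _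

  ⇒ᵇ-elim : ∀ {p q} → T (p ⇒ᵇ q) → T p → T q
  ⇒ᵇ-elim {true} tq _ = tq

  allB anyB : ℕ → (ℕ → Bool) → Bool
  allB zero    P = true
  allB (suc k) P = P k ∧ allB k P
  anyB zero    P = false
  anyB (suc k) P = P k ∨ anyB k P

  sumN : ℕ → (ℕ → ℕ) → ℕ
  sumN zero    F = 0
  sumN (suc k) F = F k + sumN k F

  allB-elim : ∀ k {P} → T (allB k P) → ∀ i → i < k → T (P i)
  allB-elim (suc k) {P} all i i<1+k with m≤n⇒m<n∨m≡n (≤-pred i<1+k)
  ... | inj₁ i<k  = allB-elim k (proj₂ (∧-elim {P k} all)) i i<k
  ... | inj₂ refl = proj₁ (∧-elim {P k} all)

  allB-intro : ∀ k {P} → (∀ i → i < k → T (P i)) → T (allB k P)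
  allB-intro zero    h = _
  allB-intro (suc k) h = ∧-intro (h k ≤-refl) (allB-intro k (λ i i<k → h i (m≤n⇒m≤1+n i<k)))

  allB-cong : ∀ k {P Q} → (∀ i → i < k → P i ≡ Q i) → allB k P ≡ allB k Q
  allB-cong zero    h = refl
  allB-cong (suc k) h = cong₂ _∧_ (h k ≤-refl) (allB-cong k (λ i i<k → h i (m≤n⇒m≤1+n i<k)))

  anyB-intro : ∀ k {P} i → i < k → T (P i) → T (anyB k P)
  anyB-intro (suc k) {P} i i<1+k pi with m≤n⇒m<n∨m≡n (≤-pred i<1+k)
  ... | inj₁ i<k  = ∨-introʳ (P k) (anyB-intro k i i<k pi)
  ... | inj₂ refl = ∨-introˡ pi

  anyB-elim : ∀ k {P} → T (anyB k P) → Σ ℕ λ i → i < k × T (P i)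
  anyB-elim (suc k) {P} any with P k in eq
  ... | true  = k , ≤-refl , subst T (sym eq) _
  ... | false with anyB-elim k any
  ...   | i , i<k , pi = i , m≤n⇒m≤1+n i<k , pi

  anyB-via-allB : ∀ k P → not (allB k (λ i → not (P i))) ≡ anyB k P
  anyB-via-allB zero    P = refl
  anyB-via-allB (suc k) P with P k
  ... | true  = refl
  ... | false = anyB-via-allB k P

  least : ∀ P n → T (P n) → Σ ℕ λ m → T (P m) × (∀ k → k < m → ¬ T (P k))
  least P n pn = search n (anyB-intro (suc n) n ≤-refl pn)
    where
    search : ∀ n → T (anyB (suc n) P) → Σ ℕ λ m → T (P m) × (∀ k → k < m → ¬ T (P k))
    search zero    some = 0 , ∨-resolve some (λ ()) , λ _ ()
    search (suc n) some with T? (anyB (suc n) P)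
    ... | yes below = search n below
    ... | no  none  = suc n , ∨-resolve some none , λ k k<1+n pk → none (anyB-intro (suc n) k k<1+n pk)

  beyond-failures : ∀ {P : ℕ → Bool} b w → T (P w) → (∀ y → y ≤ b → ¬ T (P y)) → b ≤ w
  beyond-failures b w pw fails with w ≤? b
  ... | yes w≤b = ⊥-elim (fails w w≤b pw)
  ... | no  w≰b = <⇒≤ (≰⇒> w≰b)

  sumN-≥ : ∀ k F i → i < k → F i ≤ sumN k F
  sumN-≥ (suc k) F i i<1+k with m≤n⇒m<n∨m≡n (≤-pred i<1+k)
  ... | inj₁ i<k  = ≤-trans (sumN-≥ k F i i<k) (m≤n+m (sumN k F) (F k))
  ... | inj₂ refl = m≤m+n (F i) (sumN k F)

open BoundedQuantifiers

-- A natural number n codes the finite set {t : bit t of n is 1}.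
module FiniteSets where

  odd : ℕ → Bool
  odd zero    = false
  odd (suc n) = not (odd n)

  half : ℕ → ℕ
  half zero    = 0
  half (suc n) = half n + boolToℕ (odd n)

  halves : ℕ → ℕ → ℕ
  halves n zero    = n
  halves n (suc t) = half (halves n t)

  bit : ℕ → ℕ → Bool
  bit n t = odd (halves n t)

  infix 4 _∋_
  _∋_ : ℕ → ℕ → Set
  n ∋ t = T (bit n t)

  bit-suc : ∀ n t → bit n (suc t) ≡ bit (half n) t
  bit-suc n t = cong odd (halves-half t)
    where
    halves-half : ∀ t → halves n (suc t) ≡ halves (half n) t
    halves-half zero    = refl
    halves-half (suc t) = cong half (halves-half t)

  half-suc-suc : ∀ n → half (suc (suc n)) ≡ suc (half n)
  half-suc-suc n with odd n
  ... | true  = trans (+-identityʳ (half n + 1)) (+-comm (half n) 1)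
  ... | false = trans (cong (_+ 1) (+-identityʳ (half n))) (+-comm (half n) 1)

  odd-+-even : ∀ n m → odd (n + 2 * m) ≡ odd n
  odd-+-even n zero    = cong odd (+-identityʳ n)
  odd-+-even n (suc m) rewrite *-suc 2 m | +-suc n (suc (2 * m)) | +-suc n (2 * m) =
    trans (not-involutive (odd (n + 2 * m))) (odd-+-even n m)

  half-+-even : ∀ n m → half (n + 2 * m) ≡ half n + m
  half-+-even n zero    = trans (cong half (+-identityʳ n)) (sym (+-identityʳ (half n)))
  half-+-even n (suc m) rewrite *-suc 2 m | +-suc n (suc (2 * m)) | +-suc n (2 * m) | +-suc (half n) m =
    trans (half-suc-suc (n + 2 * m)) (cong suc (half-+-even n m))

  insert-new : ∀ j n → bit n j ≡ false → bit (n + 2 ^ j) j ≡ true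
  insert-new zero    n n∌j rewrite +-comm n 1 | n∌j = refl
  insert-new (suc j) n n∌j = begin
    bit (n + 2 * 2 ^ j) (suc j)  ≡⟨ bit-suc (n + 2 * 2 ^ j) j ⟩
    bit (half (n + 2 * 2 ^ j)) j ≡⟨ cong (λ m → bit m j) (half-+-even n (2 ^ j)) ⟩
    bit (half n + 2 ^ j) j       ≡⟨ insert-new j (half n) (trans (sym (bit-suc n j)) n∌j) ⟩
    true                         ∎
    where open ≡-Reasoning

  insert-old : ∀ j n t → bit n j ≡ false → t ≢ j → bit (n + 2 ^ j) t ≡ bit n t
  insert-old zero    n zero    _   t≢j = ⊥-elim (t≢j refl)
  insert-old zero    n (suc t) n∌0 _ rewrite +-comm n 1 | bit-suc (suc n) t | bit-suc n t
                                       | n∌0 | +-identityʳ (half n) = refl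
  insert-old (suc j) n zero    _   _   = odd-+-even n (2 ^ j)
  insert-old (suc j) n (suc t) n∌j t≢j = begin
    bit (n + 2 * 2 ^ j) (suc t)  ≡⟨ bit-suc (n + 2 * 2 ^ j) t ⟩
    bit (half (n + 2 * 2 ^ j)) t ≡⟨ cong (λ m → bit m t) (half-+-even n (2 ^ j)) ⟩
    bit (half n + 2 ^ j) t       ≡⟨ insert-old j (half n) t (trans (sym (bit-suc n j)) n∌j) (t≢j ∘ cong suc) ⟩
    bit (half n) t               ≡⟨ sym (bit-suc n t) ⟩
    bit n (suc t)                ∎
    where open ≡-Reasoning

  inserted : ∀ {I j t} → bit I j ≡ false → I + 2 ^ j ∋ t → t ≡ j ⊎ I ∋ t
  inserted {I} {j} {t} fresh member with t ≟ j
  ... | yes t≡j = inj₁ t≡j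
  ... | no  t≢j = inj₂ (subst T (insert-old j I t fresh t≢j) member)

  inserting : ∀ {I j t} → bit I j ≡ false → t ≡ j ⊎ I ∋ t → I + 2 ^ j ∋ t
  inserting {I} {j} fresh (inj₁ refl) = subst T (sym (insert-new j I fresh)) _
  inserting {I} {j} {t} fresh (inj₂ member) with t ≟ j
  ... | yes refl = subst T (sym (insert-new j I fresh)) _
  ... | no  t≢j  = subst T (sym (insert-old j I t fresh t≢j)) member

  1∋0 : 1 ∋ 0
  1∋0 = _

  halves-zero : ∀ t → halves 0 t ≡ 0
  halves-zero zero    = refl
  halves-zero (suc t) = cong half (halves-zero t)

  1∋-only-0 : ∀ t → 1 ∋ t → t ≡ 0
  1∋-only-0 zero    _ = refl
  1∋-only-0 (suc t) 1∋t rewrite bit-suc 1 t | halves-zero t = ⊥-elim 1∋t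

  setOf : (ℕ → Bool) → ℕ → ℕ
  setOf Q zero    = 0
  setOf Q (suc L) = boolToℕ (Q 0) + 2 * setOf (λ t → Q (suc t)) L

  bit-setOf : ∀ L Q t → t < L → bit (setOf Q L) t ≡ Q t
  bit-setOf (suc L) Q zero    _ = trans (odd-+-even (boolToℕ (Q 0)) (setOf (λ t → Q (suc t)) L)) (odd-bool (Q 0))
    where
    odd-bool : ∀ b → odd (boolToℕ b) ≡ b
    odd-bool true  = refl
    odd-bool false = refl
  bit-setOf (suc L) Q (suc t) (s≤s t<L) = begin
    bit (b + 2 * m) (suc t)  ≡⟨ bit-suc (b + 2 * m) t ⟩
    bit (half (b + 2 * m)) t ≡⟨ cong (λ k → bit k t) (half-+-even b m) ⟩
    bit (half b + m) t       ≡⟨ cong (λ k → bit (k + m) t) (half-bool (Q 0)) ⟩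
    bit m t                  ≡⟨ bit-setOf L (λ t → Q (suc t)) t t<L ⟩
    Q (suc t)                ∎
    where
    open ≡-Reasoning
    b = boolToℕ (Q 0)
    m = setOf (λ t → Q (suc t)) L
    half-bool : ∀ b → half (boolToℕ b) ≡ 0
    half-bool true  = refl
    half-bool false = refl

  setOf-< : ∀ L Q → setOf Q L < 2 ^ L
  setOf-< zero    Q = s≤s z≤n
  setOf-< (suc L) Q = begin-strict
    boolToℕ (Q 0) + 2 * m ≤⟨ +-monoˡ-≤ (2 * m) (bool≤1 (Q 0)) ⟩
    1 + 2 * m             <⟨ n<1+n (1 + 2 * m) ⟩
    2 + 2 * m             ≡⟨ sym (*-suc 2 m) ⟩
    2 * suc m             ≤⟨ *-monoʳ-≤ 2 (setOf-< L (λ t → Q (suc t))) ⟩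
    2 * 2 ^ L             ∎
    where
    open ≤-Reasoning
    m = setOf (λ t → Q (suc t)) L
    bool≤1 : ∀ b → boolToℕ b ≤ 1
    bool≤1 true  = ≤-refl
    bool≤1 false = z≤n

-- A program is indexed by
-- the function it computes, so every combinator below is correct by
-- construction and its specification is read off from its type.
module Programs where

  enc : ∀ {n} → Vec ℕ n → ℕ
  enc []      = 0
  enc (a ∷ ρ) = pair a (enc ρ)

  record Fn (X : SubsetN) (n : ℕ) (F : Vec ℕ n → ℕ) : Set where
    constructor mkFn
    field
      prog    : Code
      correct : ∀ ρ → Eval X prog (enc ρ) (F ρ)

  cast : ∀ {X n F G} → (∀ ρ → F ρ ≡ G ρ) → Fn X n F → Fn X n G
  cast F≗G (mkFn c ok) = mkFn c (λ ρ → subst (Eval _ c (enc ρ)) (F≗G ρ) (ok ρ))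

  zer : ∀ {X n} → Fn X n (λ _ → 0)
  zer = mkFn zeroC (λ _ → ev-zero)

  suc′ : ∀ {X n F} → Fn X n F → Fn X n (λ ρ → suc (F ρ))
  suc′ (mkFn c ok) = mkFn (compC succC c) (λ ρ → ev-comp (ok ρ) ev-succ)

  app : ∀ {X n f F} → ComputableFrom X f → Fn X n F → Fn X n (λ ρ → f (F ρ))
  app (p , ok-p) (mkFn c ok) = mkFn (compC p c) (λ ρ → ev-comp (ok ρ) (ok-p _))

  wk : ∀ {X n F} → Fn X n F → Fn X (suc n) (λ ρ → F (tail ρ))
  wk (mkFn c ok) = mkFn (compC c sndC) λ { (a ∷ ρ) → ev-comp (ev-snd {a = a} {b = enc ρ}) (ok ρ) }

  skip : ∀ {X n F} → Fn X (suc n) F → Fn X (suc (suc n)) (λ ρ → F (head ρ ∷ tail (tail ρ)))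
  skip (mkFn c ok) = mkFn (compC c (pairC fstC (compC sndC sndC))) λ where
    (i ∷ y ∷ ρ) → ev-comp (ev-pair (ev-fst {a = i} {b = pair y (enc ρ)})
                                   (ev-comp (ev-snd {a = i} {b = pair y (enc ρ)}) (ev-snd {a = y} {b = enc ρ})))
                          (ok (i ∷ ρ))

  var : ∀ {X n} (i : Fin n) → Fn X n (λ ρ → lookup ρ i)
  var zero    = mkFn fstC λ { (a ∷ ρ) → ev-fst {a = a} {b = enc ρ} }
  var (suc i) = cast (λ { (a ∷ ρ) → refl }) (wk (var i))

  primrec : ℕ → (ℕ → ℕ → ℕ) → ℕ → ℕ
  primrec a g zero    = a
  primrec a g (suc k) = g k (primrec a g k)

  primrec-unique : ∀ {a g} (h : ℕ → ℕ) → h 0 ≡ a → (∀ k → h (suc k) ≡ g k (h k)) →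
                   ∀ k → primrec a g k ≡ h k
  primrec-unique h h0 hs zero    = sym h0
  primrec-unique {a} {g} h h0 hs (suc k) = trans (cong (g k) (primrec-unique h h0 hs k)) (sym (hs k))

  -- the code for rec evaluates precC on ⟨k , args⟩; adapt reorders the
  -- step input ⟨args , ⟨i , y⟩⟩ to the step program's ⟨i , ⟨y , args⟩⟩
  rec : ∀ {X n Z S K} → Fn X n Z → Fn X (suc (suc n)) S → Fn X n K →
        Fn X n (λ ρ → primrec (Z ρ) (λ i y → S (i ∷ y ∷ ρ)) (K ρ))
  rec {X} {Z = Z} {S = S} {K = K} (mkFn z ok-z) (mkFn s ok-s) (mkFn k ok-k) =
    mkFn (compC (precC z (compC s adapt)) (pairC k idC))
         (λ ρ → ev-comp (ev-pair (ok-k ρ) ev-id) (iterate ρ (K ρ)))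
    where
    adapt : Code
    adapt = pairC (compC fstC sndC) (pairC (compC sndC sndC) fstC)
    iterate : ∀ ρ m → Eval X (precC z (compC s adapt)) (pair m (enc ρ))
                             (primrec (Z ρ) (λ i y → S (i ∷ y ∷ ρ)) m)
    iterate ρ zero    = ev-prec0 (ok-z ρ)
    iterate ρ (suc m) = ev-precS (iterate ρ m)
      (ev-comp (ev-pair (ev-comp (ev-snd {a = enc ρ} {b = pair m y}) (ev-fst {a = m} {b = y}))
                        (ev-pair (ev-comp (ev-snd {a = enc ρ} {b = pair m y}) (ev-snd {a = m} {b = y}))
                                 (ev-fst {a = enc ρ} {b = pair m y})))
               (ok-s (m ∷ y ∷ ρ)))
      where y = primrec (Z ρ) (λ i y → S (i ∷ y ∷ ρ)) m

  unary : ∀ {X F} → Fn X 1 F → ComputableFrom X (λ x → F (x ∷ []))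
  unary (mkFn c ok) = compC c (pairC idC zeroC) , λ x → ev-comp (ev-pair ev-id ev-zero) (ok (x ∷ []))

open Programs
open FiniteSets

module DerivedPrograms where

  lit : ∀ {X n} k → Fn X n (λ _ → k)
  lit zero    = zer
  lit (suc k) = suc′ (lit k)

  add : ∀ {X n F G} → Fn X n F → Fn X n G → Fn X n (λ ρ → F ρ + G ρ)
  add {F = F} {G} a b =
    cast (λ ρ → trans (primrec-unique (_+ F ρ) refl (λ _ → refl) (G ρ)) (+-comm (G ρ) (F ρ)))
         (rec a (suc′ (var (suc zero))) b)

  mul : ∀ {X n F G} → Fn X n F → Fn X n G → Fn X n (λ ρ → F ρ * G ρ)
  mul {F = F} {G} a b =
    cast (λ ρ → trans (primrec-unique (_* F ρ) refl (λ _ → refl) (G ρ)) (*-comm (G ρ) (F ρ)))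
         (rec zer (add (wk (wk a)) (var (suc zero))) b)

  pow2 : ∀ {X n F} → Fn X n F → Fn X n (λ ρ → 2 ^ F ρ)
  pow2 {F = F} e = cast (λ ρ → primrec-unique (2 ^_) refl (λ _ → refl) (F ρ))
                        (rec (lit 1) (mul (lit 2) (var (suc zero))) e)

  isZero : ℕ → ℕ
  isZero zero    = 1
  isZero (suc _) = 0

  isZeroF : ∀ {X n F} → Fn X n F → Fn X n (λ ρ → isZero (F ρ))
  isZeroF {F = F} e = cast (λ ρ → by-cases (F ρ)) (rec (lit 1) zer e)
    where
    by-cases : ∀ k → primrec 1 (λ _ _ → 0) k ≡ isZero k
    by-cases zero    = refl
    by-cases (suc k) = refl

  pairF : ∀ {X n F G} → Fn X n F → Fn X n G → Fn X n (λ ρ → pair (F ρ) (G ρ))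
  pairF a b = add (triF (add a b)) a
    where
    triF : ∀ {X n F} → Fn X n F → Fn X n (λ ρ → tri (F ρ))
    triF {F = F} e = cast (λ ρ → primrec-unique tri refl (λ _ → refl) (F ρ))
                          (rec zer (add (suc′ (var zero)) (var (suc zero))) e)

  fstP : ∀ {X} → ComputableFrom X π₁
  fstP = fstC , λ n → subst (λ m → Eval _ fstC m (π₁ n)) (pair-π n) (ev-fst {a = π₁ n} {b = π₂ n})

  sndP : ∀ {X} → ComputableFrom X π₂
  sndP = sndC , λ n → subst (λ m → Eval _ sndC m (π₂ n)) (pair-π n) (ev-snd {a = π₁ n} {b = π₂ n})

  sumF : ∀ {X n K F} → Fn X n K → Fn X (suc n) F →
         Fn X n (λ ρ → sumN (K ρ) (λ i → F (i ∷ ρ)))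
  sumF {K = K} {F} k body =
    cast (λ ρ → primrec-unique (λ m → sumN m (λ i → F (i ∷ ρ))) refl (λ _ → refl) (K ρ))
         (rec zer (add (skip body) (var (suc zero))) k)

  record Test (X : SubsetN) (n : ℕ) (P : Vec ℕ n → Bool) : Set where
    constructor mkTest
    field indicator : Fn X n (λ ρ → boolToℕ (P ρ))
  open Test public

  notT : ∀ {X n P} → Test X n P → Test X n (λ ρ → not (P ρ))
  notT {P = P} a = mkTest (cast (λ ρ → isZero-bool (P ρ)) (isZeroF (indicator a)))
    where
    isZero-bool : ∀ b → isZero (boolToℕ b) ≡ boolToℕ (not b)
    isZero-bool true  = refl
    isZero-bool false = refl

  andT : ∀ {X n P Q} → Test X n P → Test X n Q → Test X n (λ ρ → P ρ ∧ Q ρ)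
  andT {P = P} {Q} a b = mkTest (cast (λ ρ → mul-bool (P ρ) (Q ρ)) (mul (indicator a) (indicator b)))
    where
    mul-bool : ∀ p q → boolToℕ p * boolToℕ q ≡ boolToℕ (p ∧ q)
    mul-bool true  q = +-identityʳ (boolToℕ q)
    mul-bool false q = refl

  impT : ∀ {X n P Q} → Test X n P → Test X n Q → Test X n (λ ρ → P ρ ⇒ᵇ Q ρ)
  impT {P = P} {Q} a b = mkTest (cast (λ ρ → cong boolToℕ (imp (P ρ) (Q ρ)))
                                      (indicator (notT (andT a (notT b)))))
    where
    imp : ∀ p q → not (p ∧ not q) ≡ p ⇒ᵇ q
    imp true  q = not-involutive q
    imp false q = refl

  allT : ∀ {X n K P} → Fn X n K → Test X (suc n) P → Test X n (λ ρ → allB (K ρ) (λ i → P (i ∷ ρ)))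
  allT {K = K} {P} k body =
    mkTest (cast (λ ρ → primrec-unique (λ m → boolToℕ (allB m (λ i → P (i ∷ ρ)))) refl (λ m → step (P (m ∷ ρ)) _) (K ρ))
                 (rec (lit 1) (mul (skip (indicator body)) (var (suc zero))) k))
    where
    step : ∀ p q → boolToℕ (p ∧ q) ≡ boolToℕ p * boolToℕ q
    step true  q = sym (+-identityʳ (boolToℕ q))
    step false q = refl

  anyT : ∀ {X n K P} → Fn X n K → Test X (suc n) P → Test X n (λ ρ → anyB (K ρ) (λ i → P (i ∷ ρ)))
  anyT {K = K} {P} k body =
    mkTest (cast (λ ρ → cong boolToℕ (anyB-via-allB (K ρ) (λ i → P (i ∷ ρ))))
                 (indicator (notT (allT k (notT body)))))

  bitT : ∀ {X n S F} → Fn X n S → Fn X n F → Test X n (λ ρ → bit (S ρ) (F ρ))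
  bitT {S = S} {F} s t = mkTest (oddF (halvesF s t))
    where
    oddF : ∀ {X n F} → Fn X n F → Fn X n (λ ρ → boolToℕ (odd (F ρ)))
    oddF {F = F} e = cast (λ ρ → primrec-unique (boolToℕ ∘ odd) refl (λ m → odd-step (odd m)) (F ρ))
                          (rec zer (isZeroF (var (suc zero))) e)
      where
      odd-step : ∀ b → boolToℕ (not b) ≡ isZero (boolToℕ b)
      odd-step true  = refl
      odd-step false = refl
    halfF : ∀ {X n F} → Fn X n F → Fn X n (λ ρ → half (F ρ))
    halfF {F = F} e = cast (λ ρ → primrec-unique half refl (λ _ → refl) (F ρ))
                           (rec zer (add (var (suc zero)) (oddF (var zero))) e)
    halvesF : ∀ {X n S F} → Fn X n S → Fn X n F → Fn X n (λ ρ → halves (S ρ) (F ρ))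
    halvesF {S = S} {F} s t = cast (λ ρ → primrec-unique (halves (S ρ)) refl (λ _ → refl) (F ρ))
                                   (rec s (halfF (var (suc zero))) t)

  reducible-by-test : ∀ {X} (Y : SubsetN) (P : ℕ → Bool) →
                      (∀ n → Y n → T (P n)) → (∀ n → T (P n) → Y n) →
                      ComputableFrom X (λ n → boolToℕ (P n)) → TuringReducible Y X
  reducible-by-test Y P complete sound (c , runs) = c , λ n → yes-case n , no-case n
    where
    yes-case : ∀ n → Y n → Eval _ c n 1
    yes-case n y with P n | complete n y | runs n
    ... | true | _ | run = run
    no-case : ∀ n → ¬ Y n → Eval _ c n 0
    no-case n ¬y with P n | sound n | runs n
    ... | true  | s | _   = ⊥-elim (¬y (s _))
    ... | false | _ | run = run

open DerivedPrograms

-- The least-witness function of a relation Q with an oracle-free decision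
-- procedure is computable relative to the halting problem: ∅′ tells whether
-- a witness exists, and if so an unbounded search finds the least one.
module LeastWitness (lem : ExcludedMiddle 0ℓ) (Q : ℕ → ℕ → Bool)
    (refuteQ : ComputableFrom ∅ (λ p → boolToℕ (not (Q (π₂ p) (π₁ p))))) where

  Witnessed : ℕ → Set
  Witnessed z = Σ ℕ λ x → T (Q z x)

  leastOf : ∀ z → Witnessed z → ℕ
  leastOf z (x , qx) = proj₁ (least (Q z) x qx)

  leastWitness : ℕ → ℕ
  leastWitness z = choose (lem {Witnessed z})
    where
    choose : Dec (Witnessed z) → ℕ
    choose (yes w) = leastOf z w
    choose (no _)  = 0

  leastWitness-spec : ∀ z → Witnessed z → T (Q z (leastWitness z))
  leastWitness-spec z w with lem {Witnessed z}
  ... | yes (x , qx) = proj₁ (proj₂ (least (Q z) x qx))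
  ... | no ¬w        = ⊥-elim (¬w w)

  private
    c : Code
    c = proj₁ refuteQ

    refute-pair : ∀ x z → boolToℕ (not (Q (π₂ (pair x z)) (π₁ (pair x z)))) ≡ boolToℕ (not (Q z x))
    refute-pair x z = cong₂ (λ a b → boolToℕ (not (Q a b))) (π₂-pair x z) (π₁-pair x z)

    refutes : ∀ {X} c′ → (∀ p → Eval X c′ p (boolToℕ (not (Q (π₂ p) (π₁ p))))) →
              ∀ x z → Eval X c′ (pair x z) (boolToℕ (not (Q z x)))
    refutes c′ ok x z = subst (Eval _ c′ (pair x z)) (refute-pair x z) (ok (pair x z))

    search-runs : ∀ {X} c′ → (∀ p → Eval X c′ p (boolToℕ (not (Q (π₂ p) (π₁ p))))) →
                  ∀ z (w : Witnessed z) → Eval X (muC c′) z (leastOf z w)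
    search-runs c′ ok z (x , qx) with least (Q z) x qx
    ... | m , qm , below = ev-mu found-m (λ k k<m → 0 , not-found-k k k<m)
      where
      found-m : Eval _ c′ (pair m z) 0
      found-m = subst (Eval _ c′ (pair m z)) (cong (boolToℕ ∘ not) (T⇒true qm)) (refutes c′ ok m z)
      not-found-k : ∀ k → k < m → Eval _ c′ (pair k z) 1
      not-found-k k k<m =
        subst (Eval _ c′ (pair k z)) (cong (boolToℕ ∘ not) (¬T⇒false (below k k<m))) (refutes c′ ok k z)

    search-sound : ∀ z y → Eval ∅ (muC c) z y → T (Q z y)
    search-sound z y (ev-mu found _) with Q z y | deterministic found (refutes c (proj₂ refuteQ) y z) refl
    ... | true | _ = _

    index : ℕ
    index = Encoding.encode (muC c)

    -- z ↦ ⟨index , z⟩, the oracle question “does the search on z halt?”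
    question : ComputableFrom ∅′ (λ z → pair index z)
    question = unary (pairF (lit index) (var zero))

  -- on input z: ask ∅′ whether the search halts; if so run it, else answer 0
  leastWitness-computable : ComputableFrom ∅′ leastWitness
  leastWitness-computable =
    compC (precC zeroC (compC (muC (strip c)) fstC)) (pairC (compC orcC (proj₁ question)) idC) , runs
    where
    runs : ∀ z → Eval ∅′ _ z (leastWitness z)
    runs z with lem {Witnessed z}
    ... | yes w = ev-comp (ev-pair (ev-comp (proj₂ question z) (ev-orc1 halts)) ev-id)
                          (ev-precS {n = 0} {x = z} {y = 0} (ev-prec0 {x = z} ev-zero)
                            (ev-comp (ev-fst {a = z} {b = pair 0 0})
                                     (search-runs (strip c) (λ p → strip-runs (proj₂ refuteQ p)) z w)))
      where
      halts : ∅′ (pair index z)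
      halts = index , z , refl , leastOf z w ,
              subst (λ c′ → Eval ∅ c′ z (leastOf z w)) (sym (Encoding.decode-encode (muC c)))
                    (search-runs c (proj₂ refuteQ) z w)
    ... | no ¬w = ev-comp (ev-pair (ev-comp (proj₂ question z) (ev-orc0 diverges)) ev-id)
                          (ev-prec0 {x = z} ev-zero)
      where
      diverges : ¬ ∅′ (pair index z)
      diverges (e , z′ , eq , y , halts) with pair-injective {index} {z} {e} {z′} eq
      ... | refl , refl =
        ¬w (y , search-sound z y (subst (λ c′ → Eval ∅ c′ z y) (Encoding.decode-encode (muC c)) halts))

-- In a family with the F intersection property all of whose members are
-- nonempty, ANY finitely many members (repetitions allowed) have a common
-- point: repeated sets are discarded one at a time, which needs excluded
-- middle to decide whether two members coincide.
module CommonPoint (lem : ExcludedMiddle 0ℓ) (C : Family) (C-FIP : FIP C)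
                   (C-nonempty : ∀ i → Σ ℕ (C i)) where

  CommonPoint : ∀ {m} → (Fin m → ℕ) → Set
  CommonPoint g = Σ ℕ λ x → ∀ k → C (g k) x

  drop-duplicate : ∀ {m} (g : Fin (suc m) → ℕ) k l → k ≢ l → C (g k) ≐ C (g l) →
                   CommonPoint (λ i → g (punchIn l i)) → CommonPoint g
  drop-duplicate g k l k≢l Ck≐Cl (x , in-others) = x , in-all
    where
    in-other : ∀ k′ → l ≢ k′ → C (g k′) x
    in-other k′ l≢k′ = subst (λ i → C (g i) x) (punchIn-punchOut l≢k′) (in-others (punchOut l≢k′))
    in-all : ∀ k′ → C (g k′) x
    in-all k′ with lem {k′ ≡ l}
    ... | yes refl  = proj₁ (Ck≐Cl x) (in-other k (k≢l ∘ sym))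
    ... | no  k′≢l  = in-other k′ (k′≢l ∘ sym)

  Duplicate : ∀ {m} → (Fin m → ℕ) → Set
  Duplicate {m} g = Σ (Fin m) λ k → Σ (Fin m) λ l → k ≢ l × (C (g k) ≐ C (g l))

  common-point : ∀ m (g : Fin m → ℕ) → CommonPoint g
  common-point zero          g = 0 , λ ()
  common-point (suc zero)    g = proj₁ (C-nonempty (g zero)) , λ { zero → proj₂ (C-nonempty (g zero)) }
  common-point (suc (suc m)) g = by-cases (lem {Duplicate g}) (common-point (suc m))
    where
    by-cases : Dec (Duplicate g) → (∀ g′ → CommonPoint g′) → CommonPoint g
    by-cases (yes (k , l , k≢l , Ck≐Cl)) shorter =
      drop-duplicate g k l k≢l Ck≐Cl (shorter (λ i → g (punchIn l i)))
    by-cases (no distinct) _ =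
      C-FIP (suc (suc m)) (s≤s (s≤s z≤n)) g (λ k l k≢l Ck≐Cl → distinct (k , l , k≢l , Ck≐Cl))

-- Stage s is a number coding a finite set of indices; stage s+1
-- runs through j = 0, …, s and adds j when A j meets the intersection of the
-- sets chosen so far at a point below the search bound f s.
module Construction (lem : ExcludedMiddle 0ℓ) (A : Family) (A-computable : ComputableFamily A)
                    (A-nonempty : ∀ j → Σ ℕ (A j)) where

  inA : ℕ → ℕ → Bool
  inA i x = does (lem {code A (pair i x)})

  inA-complete : ∀ {i x} → A i x → T (inA i x)
  inA-complete {i} {x} a with lem {code A (pair i x)}
  ... | yes _ = _
  ... | no ¬a = ¬a (i , x , refl , a)

  inA-sound : ∀ {i x} → T (inA i x) → A i x
  inA-sound {i} {x} t with lem {code A (pair i x)}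
  ... | no _ = ⊥-elim t
  ... | yes (i′ , x′ , eq , a) with pair-injective {i} {x} {i′} {x′} eq
  ...   | refl , refl = a

  inA-test : ∀ {X n I F} → Fn X n I → Fn X n F → Test X n (λ ρ → inA (I ρ) (F ρ))
  inA-test i x = mkTest (app decideA (pairF i x))
    where
    decides : ∀ n → Eval ∅ (proj₁ A-computable) n (boolToℕ (does (lem {code A n})))
    decides n with lem {code A n}
    ... | yes a = proj₁ (proj₂ A-computable n) a
    ... | no ¬a = proj₂ (proj₂ A-computable n) ¬a
    decideA : ∀ {X} → ComputableFrom X (λ n → boolToℕ (does (lem {code A n})))
    decideA = strip (proj₁ A-computable) , λ n → strip-runs (decides n)

  meets : (j I s x : ℕ) → Bool
  meets j I s x = inA j x ∧ allB (suc s) (λ t → bit I t ⇒ᵇ inA t x)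

  meetsT : ∀ {X n J I S F} → Fn X n J → Fn X n I → Fn X n S → Fn X n F →
           Test X n (λ ρ → meets (J ρ) (I ρ) (S ρ) (F ρ))
  meetsT j i s x = andT (inA-test j x) (allT (suc′ s) (impT (bitT (wk i) (var zero)) (inA-test (var zero) (wk x))))

  joins : (s b I j : ℕ) → Bool
  joins s b I j = not (bit I j) ∧ anyB (suc b) (meets j I s)

  step : (s b I j : ℕ) → ℕ
  step s b I j = if joins s b I j then I + 2 ^ j else I

  sweep : (s b I c : ℕ) → ℕ
  sweep s b I c = primrec I (λ j I′ → step s b I′ j) c

  -- the sweep is computable from its parameters; a step computes I + [joins]·2ʲ
  sweepF : ∀ {X n S B I K} → Fn X n S → Fn X n B → Fn X n I → Fn X n K →
           Fn X n (λ ρ → sweep (S ρ) (B ρ) (I ρ) (K ρ))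
  sweepF s b i k = rec i (stepF (wk (wk s)) (wk (wk b)) (var (suc zero)) (var zero)) k
    where
    select : ∀ c I p → I + boolToℕ c * p ≡ (if c then I + p else I)
    select true  I p = cong (I +_) (+-identityʳ p)
    select false I p = +-identityʳ I
    stepF : ∀ {X n S B I J} → Fn X n S → Fn X n B → Fn X n I → Fn X n J →
            Fn X n (λ ρ → step (S ρ) (B ρ) (I ρ) (J ρ))
    stepF {S = S} {B} {I} {J} s b i j =
      cast (λ ρ → select (joins (S ρ) (B ρ) (I ρ) (J ρ)) (I ρ) (2 ^ J ρ))
           (add i (mul (indicator (andT (notT (bitT i j)) (anyT (suc′ b) (meetsT (wk j) (wk i) (wk s) (var zero)))))
                       (pow2 j)))

  step-view : ∀ s b I j → step s b I j ≡ I
                        ⊎ (bit I j ≡ false × T (anyB (suc b) (meets j I s)) × step s b I j ≡ I + 2 ^ j)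
  step-view s b I j with bit I j | anyB (suc b) (meets j I s)
  ... | true  | _     = inj₁ refl
  ... | false | false = inj₁ refl
  ... | false | true  = inj₂ (refl , _ , refl)

  step-grows : ∀ s b I j t → I ∋ t → step s b I j ∋ t
  step-grows s b I j t member with step-view s b I j
  ... | inj₁ same                 = subst (_∋ t) (sym same) member
  ... | inj₂ (fresh , _ , added) = subst (_∋ t) (sym added) (inserting {I} {j} {t} fresh (inj₂ member))

  record Good (s I : ℕ) : Set where
    field
      bounded : ∀ t → I ∋ t → t ≤ s
      has-0   : I ∋ 0
      common  : Σ ℕ λ x → ∀ t → I ∋ t → A t x
  open Good

  found-point : ∀ {s I j x} → Good s I → T (meets j I s x) → ∀ t → t ≡ j ⊎ I ∋ t → A t x
  found-point {j = j} {x} _ found t (inj₁ refl) = inA-sound (proj₁ (∧-elim {inA j x} found))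
  found-point {s} {I} {j} {x} good found t (inj₂ member) =
    inA-sound (⇒ᵇ-elim {bit I t} (allB-elim (suc s) (proj₂ (∧-elim {inA j x} found)) t (s≤s (bounded good t member)))
                        member)

  step-good : ∀ s b I j → j ≤ s → Good s I → Good s (step s b I j)
  step-good s b I j j≤s good with step-view s b I j
  ... | inj₁ same = subst (Good s) (sym same) good
  ... | inj₂ (fresh , some , added) = subst (Good s) (sym added) record
    { bounded = λ t member → bounded′ t (inserted {I} {j} {t} fresh member)
    ; has-0   = inserting {I} {j} {0} fresh (inj₂ (has-0 good))
    ; common  = x , λ t member → found-point {s} {I} {j} {x} good found t (inserted {I} {j} {t} fresh member)
    }
    where
    bounded′ : ∀ t → t ≡ j ⊎ I ∋ t → t ≤ s
    bounded′ t (inj₁ refl)   = j≤s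
    bounded′ t (inj₂ member) = bounded good t member
    x = proj₁ (anyB-elim (suc b) some)
    found = proj₂ (proj₂ (anyB-elim (suc b) some))

  sweep-good : ∀ s b I c → c ≤ suc s → Good s I → Good s (sweep s b I c)
  sweep-good s b I zero    _   good = good
  sweep-good s b I (suc c) c≤s good =
    step-good s b (sweep s b I c) c (≤-pred c≤s) (sweep-good s b I c (m≤n⇒m≤1+n (≤-pred c≤s)) good)

  sweep-grows : ∀ s b I c d t → sweep s b I c ∋ t → sweep s b I (d + c) ∋ t
  sweep-grows s b I c zero    t member = member
  sweep-grows s b I c (suc d) t member =
    step-grows s b (sweep s b I (d + c)) (d + c) t (sweep-grows s b I c d t member)

  sweep-mono : ∀ s b I {c c′} t → c ≤ c′ → sweep s b I c ∋ t → sweep s b I c′ ∋ t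
  sweep-mono s b I {c} {c′} t c≤c′ member =
    subst (λ k → sweep s b I k ∋ t) (m∸n+n≡m c≤c′) (sweep-grows s b I c (c′ ∸ c) t member)

  step-adds : ∀ s b I j → bit I j ≡ false → T (anyB (suc b) (meets j I s)) → step s b I j ∋ j
  step-adds s b I j fresh some rewrite fresh with anyB (suc b) (meets j I s)
  ... | true = subst T (sym (insert-new j I fresh)) _

  meets-intro : ∀ {j I s x} → A j x → (∀ t → t ≤ s → I ∋ t → A t x) → T (meets j I s x)
  meets-intro {s = s} in-j in-I =
    ∧-intro (inA-complete in-j)
            (allB-intro (suc s) λ t t≤s → ⇒ᵇ-intro λ member → inA-complete (in-I t (≤-pred t≤s) member))

  meets-restrict : ∀ j I s x → meets j (setOf (bit I) (suc s)) s x ≡ meets j I s x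
  meets-restrict j I s x =
    cong (inA j x ∧_) (allB-cong (suc s) λ t t≤s → cong (_⇒ᵇ inA t x) (bit-setOf (suc s) (bit I) t t≤s))

  -- The search bound that the construction is compared with:
  -- bound s sums, over j ≤ s and all codes S < 2^(s+1) of subsets of
  -- {0,…,s}, the least point witnessing meets j S s.
  Meets : ℕ → ℕ → Bool
  Meets z x = meets (π₁ z) (π₁ (π₂ z)) (π₂ (π₂ z)) x

  Meets-pair : ∀ j S s x → Meets (pair j (pair S s)) x ≡ meets j S s x
  Meets-pair j S s x
    rewrite π₁-pair j (pair S s) | π₂-pair j (pair S s) | π₁-pair S s | π₂-pair S s = refl

  refuteMeets : ComputableFrom ∅ (λ p → boolToℕ (not (Meets (π₂ p) (π₁ p))))
  refuteMeets = unary (indicator (notT (meetsT (app fstP (app sndP (var zero)))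
                                                (app fstP (app sndP (app sndP (var zero))))
                                                (app sndP (app sndP (app sndP (var zero))))
                                                (app fstP (var zero)))))

  open LeastWitness lem Meets refuteMeets

  bound : ℕ → ℕ
  bound s = sumN (suc s) (λ j → sumN (2 ^ suc s) (λ S → leastWitness (pair j (pair S s))))

  bound-computable : ComputableFrom ∅′ bound
  bound-computable =
    unary (sumF (suc′ (var zero))
                (sumF (pow2 (suc′ (var (suc zero))))
                      (app leastWitness-computable (pairF (var (suc zero)) (pairF (var zero) (var (suc (suc zero))))))))

  bound-≥ : ∀ s j S → j ≤ s → S < 2 ^ suc s → leastWitness (pair j (pair S s)) ≤ bound s
  bound-≥ s j S j≤s S<2ˢ =
    ≤-trans (sumN-≥ (2 ^ suc s) (λ S′ → leastWitness (pair j (pair S′ s))) S S<2ˢ)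
            (sumN-≥ (suc s) (λ j′ → sumN (2 ^ suc s) (λ S′ → leastWitness (pair j′ (pair S′ s)))) j (s≤s j≤s))

  witness-beyond : ∀ j S s b → Σ ℕ (λ x → T (meets j S s x)) → (∀ y → y ≤ b → ¬ T (meets j S s y)) →
                   b ≤ leastWitness (pair j (pair S s))
  witness-beyond j S s b (x , found) small = beyond-failures {meets j S s} b w found-w small
    where
    z w : ℕ
    z = pair j (pair S s)
    w = leastWitness z
    witnessed : Witnessed z
    witnessed = x , subst T (sym (Meets-pair j S s x)) found
    found-w : T (meets j S s w)
    found-w = subst T (Meets-pair j S s w) (leastWitness-spec z witnessed)

  module Stages (D : SubsetN) (f : ℕ → ℕ) (f-computable : ComputableFrom D f) where

    stage : ℕ → ℕ
    stage zero    = 1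
    stage (suc s) = sweep s (f s) (stage s) (suc s)

    stageF : ∀ {n S} → Fn D n S → Fn D n (λ ρ → stage (S ρ))
    stageF {S = S} s =
      cast (λ ρ → primrec-unique stage refl (λ _ → refl) (S ρ))
           (rec (lit 1) (sweepF (var zero) (app f-computable (var zero)) (var (suc zero)) (suc′ (var zero))) s)

    stage-good : ∀ s → Good s (stage s)
    stage-good zero = record
      { bounded = λ t member → ≤-reflexive (1∋-only-0 t member)
      ; has-0   = 1∋0
      ; common  = proj₁ (A-nonempty 0) ,
                  λ t member → subst (λ i → A i _) (sym (1∋-only-0 t member)) (proj₂ (A-nonempty 0))
      }
    stage-good (suc s) = record { bounded = λ t member → m≤n⇒m≤1+n (bounded good t member)
                                ; has-0 = has-0 good ; common = common good }
      where good = sweep-good s (f s) (stage s) (suc s) ≤-refl (stage-good s)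

    stage-grows : ∀ s d t → stage s ∋ t → stage (d + s) ∋ t
    stage-grows s zero    t member = member
    stage-grows s (suc d) t member =
      sweep-mono (d + s) (f (d + s)) (stage (d + s)) {0} {suc (d + s)} t z≤n (stage-grows s d t member)

    stage-mono : ∀ {s s′} t → s ≤ s′ → stage s ∋ t → stage s′ ∋ t
    stage-mono {s} {s′} t s≤s′ member =
      subst (λ k → stage k ∋ t) (m∸n+n≡m s≤s′) (stage-grows s (s′ ∸ s) t member)

    -- ⟨t , s⟩ names t if t ∈ stage s, and 0 otherwise
    chosen : ℕ → ℕ
    chosen i = if bit (stage (π₂ i)) (π₁ i) then π₁ i else 0

    B : Family
    B i = A (chosen i)

    chosen-member : ∀ i → stage (π₂ i) ∋ chosen i
    chosen-member i with bit (stage (π₂ i)) (π₁ i) in member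
    ... | true  = subst T (sym member) _
    ... | false = has-0 (stage-good (π₂ i))

    chosen-pair : ∀ t s → stage s ∋ t → chosen (pair t s) ≡ t
    chosen-pair t s member rewrite π₁-pair t s | π₂-pair t s with bit (stage s) t
    ... | true = refl

    B-subfamily : Subfamily B A
    B-subfamily i = chosen i , λ x → (λ b → b) , (λ a → a)

    B-computable : ComputesFamily D B
    B-computable = reducible-by-test (code B) (λ n → inA (chosen (π₁ n)) (π₂ n)) complete sound
                     (unary (indicator (inA-test (chosenF (app fstP (var zero))) (app sndP (var zero)))))
      where
      select : ∀ c t → boolToℕ c * t ≡ (if c then t else 0)
      select true  t = +-identityʳ t
      select false t = refl
      chosenF : ∀ {n I} → Fn D n I → Fn D n (λ ρ → chosen (I ρ))
      chosenF {I = I} i = cast (λ ρ → select (bit (stage (π₂ (I ρ))) (π₁ (I ρ))) (π₁ (I ρ)))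
                               (mul (indicator (bitT (stageF (app sndP i)) (app fstP i))) (app fstP i))
      complete : ∀ n → code B n → T (inA (chosen (π₁ n)) (π₂ n))
      complete _ (i , x , refl , b) rewrite π₁-pair i x | π₂-pair i x = inA-complete b
      sound : ∀ n → T (inA (chosen (π₁ n)) (π₂ n)) → code B n
      sound n found = π₁ n , π₂ n , sym (pair-π n) , inA-sound found

    common-stage : ∀ m (g : Fin m → ℕ) → (∀ k → Σ ℕ λ s → stage s ∋ g k) → Σ ℕ λ s → ∀ k → stage s ∋ g k
    common-stage zero    g _       = 0 , λ ()
    common-stage (suc m) g somewhere with common-stage m (g ∘ suc) (somewhere ∘ suc) | somewhere zero
    ... | s , rest | s₀ , first = s ⊔ s₀ , λ where
      zero    → stage-mono (g zero) (m≤n⊔m s s₀) first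
      (suc k) → stage-mono (g (suc k)) (m≤m⊔n s s₀) (rest k)

    -- any finitely many members of B meet: their indices lie in one stage
    B-FIP : FIP B
    B-FIP m _ idx _ with common-stage m (chosen ∘ idx) (λ k → π₂ (idx k) , chosen-member (idx k))
    ... | s , all-in = proj₁ (common (stage-good s)) ,
                       λ k → proj₂ (common (stage-good s)) (chosen (idx k)) (all-in k)

    -- Let C ⊇ B be a subfamily of A with the F intersection
    -- property.  If a member A a of C never entered a stage, then at every
    -- level s ≥ a the search for a point of A a ∩ ⋂(chosen sets) below f s
    -- failed although such a point exists; hence f s ≤ bound s.
    module Maximality (C : Family) (C⊆A : Subfamily C A) (C-FIP : FIP C) (B⊆C : Subfamily B C) where

      C-nonempty : ∀ i → Σ ℕ (C i)
      C-nonempty i with C⊆A i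
      ... | a , Ci≐Aa = proj₁ (A-nonempty a) , proj₂ (Ci≐Aa _) (proj₂ (A-nonempty a))

      open CommonPoint lem C C-FIP C-nonempty

      meets-chosen : ∀ i a s → C i ≐ A a → Σ ℕ λ x → A a x × (∀ t → t ≤ s → stage (suc s) ∋ t → A t x)
      meets-chosen i a s Ci≐Aa = x , proj₁ (Ci≐Aa x) (in-all zero) , in-chosen
        where
        named : ℕ → ℕ
        named t = proj₁ (B⊆C (pair t (suc s)))
        idx : Fin (suc (suc s)) → ℕ
        idx zero    = i
        idx (suc t) = named (toℕ t)
        x = proj₁ (common-point _ idx)
        in-all = proj₂ (common-point _ idx)
        in-chosen : ∀ t → t ≤ s → stage (suc s) ∋ t → A t x
        in-chosen t t≤s member =
          subst (λ k → A k x) (chosen-pair t (suc s) member)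
                (proj₂ (proj₂ (B⊆C (pair t (suc s))) x)
                       (subst (λ k → C (named k) x) (toℕ-fromℕ< (s≤s t≤s)) (in-all (suc (fromℕ< (s≤s t≤s))))))

      missed-dominated : ∀ i a → C i ≐ A a → ¬ (Σ ℕ λ s → stage s ∋ a) → ∀ s → a ≤ s → f s ≤ bound s
      missed-dominated i a Ci≐Aa never s a≤s =
        ≤-trans (witness-beyond a S s (f s) (x , found)
                                (λ y y≤fs → small y y≤fs ∘ subst T (meets-restrict a I s y)))
                (bound-≥ s a S a≤s (setOf-< (suc s) (bit I)))
        where
        -- the set just before a is considered at level s, and its restriction to {0,…,s}
        I = sweep s (f s) (stage s) a
        S = setOf (bit I) (suc s)
        reaches : ∀ {c} t → c ≤ suc s → sweep s (f s) (stage s) c ∋ t → stage (suc s) ∋ t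
        reaches {c} t c≤ member = sweep-mono s (f s) (stage s) {c} {suc s} t c≤ member
        fresh : bit I a ≡ false
        fresh with bit I a in member
        ... | true  = ⊥-elim (never (suc s , reaches {a} a (m≤n⇒m≤1+n a≤s) (subst T (sym member) _)))
        ... | false = refl
        small : ∀ y → y ≤ f s → ¬ T (meets a I s y)
        small y y≤fs found-y =
          never (suc s , reaches {suc a} a (s≤s a≤s)
                           (step-adds s (f s) I a fresh (anyB-intro (suc (f s)) y (s≤s y≤fs) found-y)))
        x = proj₁ (meets-chosen i a s Ci≐Aa)
        found : T (meets a S s x)
        found = subst T (sym (meets-restrict a I s x))
                  (meets-intro (proj₁ (proj₂ (meets-chosen i a s Ci≐Aa)))
                               (λ t t≤s member → proj₂ (proj₂ (meets-chosen i a s Ci≐Aa)) t t≤s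
                                                   (reaches {a} t (m≤n⇒m≤1+n a≤s) member)))

      -- a member of C lies in B: either its index entered a stage, or f is dominated
      member-of-B : ¬ Dominates bound f → ∀ i a → C i ≐ A a → Σ ℕ λ j → C i ≐ B j
      member-of-B escapes i a Ci≐Aa = by-cases (lem {Σ ℕ λ s → stage s ∋ a})
        where
        by-cases : Dec (Σ ℕ λ s → stage s ∋ a) → Σ ℕ λ j → C i ≐ B j
        by-cases (no never)         = ⊥-elim (escapes (a , missed-dominated i a Ci≐Aa never))
        by-cases (yes (s , member)) = pair a s , λ x →
          (λ c → subst (λ k → A k x) (sym (chosen-pair a s member)) (proj₁ (Ci≐Aa x) c)) ,
          (λ b → proj₂ (Ci≐Aa x) (subst (λ k → A k x) (chosen-pair a s member) b))

      maximal : ¬ Dominates bound f → Subfamily C B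
      maximal escapes i = member-of-B escapes i (proj₁ (C⊆A i)) (proj₂ (C⊆A i))

-- If some member A j is empty, the constant family A j is a maximal
-- subfamily with the F intersection property, computable from any oracle:
-- a family with the property containing ∅ has no two distinct members.
module EmptyMember (lem : ExcludedMiddle 0ℓ) (A : Family) (j : ℕ) (empty : ¬ Σ ℕ (A j)) where

  B : Family
  B _ = A j

  B-computable : ∀ D → ComputesFamily D B
  B-computable D = zeroC , λ n → (λ { (_ , x , _ , a) → ⊥-elim (empty (x , a)) }) , (λ _ → ev-zero)

  B-subfamily : Subfamily B A
  B-subfamily _ = j , λ x → (λ a → a) , (λ a → a)

  B-FIP : FIP B
  B-FIP (suc zero)    (s≤s ()) _ _
  B-FIP (suc (suc m)) _ idx distinct = ⊥-elim (distinct zero (suc zero) (λ ()) (λ x → (λ a → a) , (λ a → a)))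

  B-maximal : ∀ C → Subfamily C A → FIP C → Subfamily B C → Subfamily C B
  B-maximal C C⊆A C-FIP B⊆C i = 0 , λ x → (λ c → ⊥-elim (Ci-empty x c)) , (λ a → ⊥-elim (empty (x , a)))
    where
    e = proj₁ (B⊆C 0)
    Ce≐Aj = proj₂ (B⊆C 0)
    Ci-empty : ∀ x → ¬ C i x
    Ci-empty x c with lem {C i ≐ C e}
    ... | yes Ci≐Ce = empty (x , proj₂ (Ce≐Aj x) (proj₁ (Ci≐Ce x) c))
    ... | no  Ci≢Ce = empty (y , proj₂ (Ce≐Aj y) (in-both (suc zero)))
      where
      idx : Fin 2 → ℕ
      idx zero       = i
      idx (suc zero) = e
      distinct : ∀ k l → k ≢ l → ¬ (C (idx k) ≐ C (idx l))
      distinct zero       zero       k≢l = ⊥-elim (k≢l refl)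
      distinct zero       (suc zero) _   = Ci≢Ce
      distinct (suc zero) zero       _   = λ Ce≐Ci → Ci≢Ce (λ z → proj₂ (Ce≐Ci z) , proj₁ (Ce≐Ci z))
      distinct (suc zero) (suc zero) k≢l = ⊥-elim (k≢l refl)
      y = proj₁ (C-FIP 2 (s≤s (s≤s z≤n)) idx distinct)
      in-both = proj₂ (C-FIP 2 (s≤s (s≤s z≤n)) idx distinct)

  solution : ∀ D → Σ Family (λ B → ComputesFamily D B × MaximalFIPSubfamily B A)
  solution D = B , B-computable D , B-subfamily , B-FIP , B-maximal

-- Proposition 4.3.
proposition4p3 : ExcludedMiddle 0ℓ → (A : Family) → ComputableFamily A → Nontrivial A →
    (D : SubsetN) → HyperimmuneRel0′ D →
    Σ Family (λ B → ComputesFamily D B × MaximalFIPSubfamily B A)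
proposition4p3 lem A A-computable _ D (f , f-computable , escapes) = by-cases (lem {Σ ℕ λ j → ¬ Σ ℕ (A j)})
  where
  by-cases : Dec (Σ ℕ λ j → ¬ Σ ℕ (A j)) → Σ Family (λ B → ComputesFamily D B × MaximalFIPSubfamily B A)
  by-cases (yes (j , empty)) = EmptyMember.solution lem A j empty D
  by-cases (no  no-empty)    =
    B , B-computable , B-subfamily , B-FIP ,
    λ C C⊆A C-FIP B⊆C → Maximality.maximal C C⊆A C-FIP B⊆C (escapes bound bound-computable)
    where
    nonempty : ∀ j → Σ ℕ (A j)
    nonempty j with lem {Σ ℕ (A j)}
    ... | yes inhabited = inhabited
    ... | no  empty     = ⊥-elim (no-empty (j , empty))
    open Construction lem A A-computable nonempty
    open Stages D f f-computable
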